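{- Let $G$ be a finite simple graph, $k\ge 1$, and let $X$ be a clique of size $3$ in the $k$-supertoken graph $\mathcal F_k(G)$. Then $G$ contains a clique of size $3$. Furthermore, the three elements of $X$ can be named $A,B,C$ so that one of the following holds: (Type 1) there is a multiset $S=\{a_1,\ldots,a_{k-1}\}$ of $k-1$ vertices of $G$ and a 3-clique $\{a,b,c\}$ of $G$ such that $A=S\uplus\{a\}$, $B=S\uplus\{b\}$, $C=S\uplus\{c\}$; (Type 2) there is a multiset $T=\{a_1,\ldots,a_{k-2}\}$ of $k-2$ vertices of $G$ and a 3-clique $\{a,a_{k-1},b\}$ of $G$ such that $A=T\uplus\{a_{k-1},a\}$, $B=T\uplus\{a_{k-1},b\}$, $C=T\uplus\{b,a\}$.
   Context: For a finite simple graph $G$ and integer $k\ge 1$, the $k$-supertoken graph $\mathcal F_k(G)$ has as vertices all multisets of size $k$ of elements of $V(G)$; two multisets $A,B$ are adjacent iff $A=S\uplus\{u\}$, $B=S\uplus\{v\}$ for some multiset $S$ of size $k-1$ and some edge $uv\in E(G)$. Here $\uplus$ denotes multiset sum (multiplicities add). -}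

module Defs where

open import Data.Nat using (ℕ; zero; suc; _+_)
open import Data.Fin using (Fin; zero; suc; _≟_)
open import Data.Product using (Σ; ∃; _×_; _,_)
open import Data.Bool using (if_then_else_)
open import Relation.Nullary using (¬_)
open import Relation.Nullary.Decidable using (⌊_⌋)
open import Relation.Binary.PropositionalEquality using (_≡_; _≢_)
open import Level using (0ℓ)
open import Relation.Binary using (Rel)

record SimpleGraph (n : ℕ) : Set₁ where
  field
    Adj    : Rel (Fin n) 0ℓ
    sym    : ∀ {u v} → Adj u v → Adj v u
    irrefl : ∀ {u} → ¬ Adj u u
open SimpleGraph public

Multiset : ℕ → Set
Multiset n = Fin n → ℕ

size : ∀ {n} → Multiset n → ℕ
size {zero}  f = 0
size {suc n} f = f zero + size (λ i → f (suc i))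

_⊎ₘ_ : ∀ {n} → Multiset n → Multiset n → Multiset n
(f ⊎ₘ g) i = f i + g i
infixl 6 _⊎ₘ_

⟦_⟧ : ∀ {n} → Fin n → Multiset n
⟦ u ⟧ i = if ⌊ u ≟ i ⌋ then 1 else 0

_≈ₘ_ : ∀ {n} → Multiset n → Multiset n → Set
f ≈ₘ g = ∀ i → f i ≡ g i
infix 4 _≈ₘ_

IsSupertoken : ∀ {n} → ℕ → Multiset n → Set
IsSupertoken k A = size A ≡ k

SupertokenAdj : ∀ {n} → SimpleGraph n → ℕ → Multiset n → Multiset n → Set
SupertokenAdj {n} G k A B =
  Σ (Multiset n) λ S → size S + 1 ≡ k ×
    (∃ λ u → ∃ λ v → Adj G u v × (A ≈ₘ S ⊎ₘ ⟦ u ⟧) × (B ≈ₘ S ⊎ₘ ⟦ v ⟧))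

IsSupertokenTriangle : ∀ {n} → SimpleGraph n → ℕ → (Fin 3 → Multiset n) → Set
IsSupertokenTriangle G k X =
  (∀ i → IsSupertoken k (X i)) ×
  (∀ i j → i ≢ j → ¬ (X i ≈ₘ X j)) ×
  (∀ i j → i ≢ j → SupertokenAdj G k (X i) (X j))

-- {a,b,c} is a 3-clique of G (distinctness follows from irreflexivity)
IsTriangle : ∀ {n} → SimpleGraph n → Fin n → Fin n → Fin n → Set
IsTriangle G a b c = Adj G a b × Adj G b c × Adj G a c

HasTriangle : ∀ {n} → SimpleGraph n → Set
HasTriangle G = ∃ λ a → ∃ λ b → ∃ λ c → IsTriangle G a b c

Type1 : ∀ {n} → SimpleGraph n → ℕ → Multiset n → Multiset n → Multiset n → Set
Type1 {n} G k A B C =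
  Σ (Multiset n) λ S → size S + 1 ≡ k ×
    (∃ λ a → ∃ λ b → ∃ λ c → IsTriangle G a b c ×
      (A ≈ₘ S ⊎ₘ ⟦ a ⟧) × (B ≈ₘ S ⊎ₘ ⟦ b ⟧) × (C ≈ₘ S ⊎ₘ ⟦ c ⟧))

Type2 : ∀ {n} → SimpleGraph n → ℕ → Multiset n → Multiset n → Multiset n → Set
Type2 {n} G k A B C =
  Σ (Multiset n) λ T → size T + 2 ≡ k ×
    (∃ λ a → ∃ λ a' → ∃ λ b → IsTriangle G a a' b ×
      (A ≈ₘ T ⊎ₘ ⟦ a' ⟧ ⊎ₘ ⟦ a ⟧) × (B ≈ₘ T ⊎ₘ ⟦ a' ⟧ ⊎ₘ ⟦ b ⟧) ×
      (C ≈ₘ T ⊎ₘ ⟦ b ⟧ ⊎ₘ ⟦ a ⟧))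

-- Write the three pairwise adjacent supertokens as A = S ⊎ {u}, B = S ⊎ {v} = S' ⊎ {x},
-- C = S' ⊎ {y}. If v = x the bases S and S' coincide and the three tokens u, v, y moved
-- from the common base form the triangle (Type 1). Otherwise B = T ⊎ {x, v}, so
-- A = T ⊎ {x, u} and C = T ⊎ {v, y}; adjacency of A and C forces the two pairs to share
-- a token, and the edges uv, xy together with v ≠ x leave only u = y (Type 2). In both
-- cases the missing edge is the single move turning A into C, whose endpoints are
-- determined by A and C.
module Submission where

open import Defs
open import Data.Nat using (ℕ; _≥_; suc; _+_; _∸_; _≤_; _<_; z≤n; s≤s)
open import Data.Nat.Properties
  using ( +-identityʳ; +-comm; +-assoc; +-cancelʳ-≡; +-monoʳ-≤; m≤m+n; m∸n+n≡m
        ; n<1+n; <⇒≱; 1+n≰n; +-commutativeSemigroup; module ≤-Reasoning )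
open import Algebra.Properties.CommutativeSemigroup +-commutativeSemigroup
  using (interchange; xy∙z≈xz∙y)
open import Data.Fin using (Fin; zero; suc; _≟_)
open import Data.Product using (Σ; _×_; _,_)
open import Data.Sum using (_⊎_; inj₁; inj₂)
open import Data.Empty using (⊥; ⊥-elim)
open import Function.Base using (id)
open import Function.Definitions using (Injective)
open import Relation.Nullary using (¬_; yes; no)
open import Relation.Binary.PropositionalEquality as ≡
  using (_≡_; _≢_; refl; trans; cong; cong₂; subst; subst₂; ≢-sym; module ≡-Reasoning)

⟦⟧-self : ∀ {n} (u : Fin n) → ⟦ u ⟧ u ≡ 1
⟦⟧-self u with u ≟ u
... | yes _   = refl
... | no u≢u = ⊥-elim (u≢u refl)

⟦⟧-other : ∀ {n} {u i : Fin n} → u ≢ i → ⟦ u ⟧ i ≡ 0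
⟦⟧-other {u = u} {i} u≢i with u ≟ i
... | yes u≡i = ⊥-elim (u≢i u≡i)
... | no _    = refl

⟦⟧≤1 : ∀ {n} (u i : Fin n) → ⟦ u ⟧ i ≤ 1
⟦⟧≤1 u i with u ≟ i
... | yes _ = s≤s z≤n
... | no _  = z≤n

⊎ₘ⟦⟧-self : ∀ {n} (M : Multiset n) (u : Fin n) → (M ⊎ₘ ⟦ u ⟧) u ≡ suc (M u)
⊎ₘ⟦⟧-self M u = trans (cong (M u +_) (⟦⟧-self u)) (+-comm (M u) 1)

⊎ₘ⟦⟧-other : ∀ {n} (M : Multiset n) {u i : Fin n} → u ≢ i → (M ⊎ₘ ⟦ u ⟧) i ≡ M i
⊎ₘ⟦⟧-other M {i = i} u≢i = trans (cong (M i +_) (⟦⟧-other u≢i)) (+-identityʳ (M i))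

size-cong : ∀ {n} {M N : Multiset n} → M ≈ₘ N → size M ≡ size N
size-cong {ℕ.zero} _   = refl
size-cong {suc n} M≈N = cong₂ _+_ (M≈N zero) (size-cong (λ i → M≈N (suc i)))

size-⊎ₘ : ∀ {n} (M N : Multiset n) → size (M ⊎ₘ N) ≡ size M + size N
size-⊎ₘ {ℕ.zero} _ _ = refl
size-⊎ₘ {suc n} M N =
  trans (cong (M zero + N zero +_) (size-⊎ₘ (λ i → M (suc i)) (λ i → N (suc i))))
        (interchange (M zero) (N zero) _ _)

size-∅ : ∀ {n} → size {n} (λ _ → 0) ≡ 0
size-∅ {ℕ.zero} = refl
size-∅ {suc n}  = size-∅ {n}

size-⟦⟧ : ∀ {n} (u : Fin n) → size ⟦ u ⟧ ≡ 1
size-⟦⟧ {suc n} zero = cong suc (size-∅ {n})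
size-⟦⟧ {suc n} (suc u) = trans (size-cong ⟦suc⟧≈⟦⟧) (size-⟦⟧ u)
  where
  ⟦suc⟧≈⟦⟧ : (λ i → ⟦ suc u ⟧ (suc i)) ≈ₘ ⟦ u ⟧
  ⟦suc⟧≈⟦⟧ i with u ≟ i
  ... | yes _ = refl
  ... | no _  = refl

size-⊎ₘ⟦⟧ : ∀ {n} (M : Multiset n) (u : Fin n) → size (M ⊎ₘ ⟦ u ⟧) ≡ size M + 1
size-⊎ₘ⟦⟧ M u = trans (size-⊎ₘ M ⟦ u ⟧) (cong (size M +_) (size-⟦⟧ u))

module _ {n : ℕ} where

  ≈ₘ-sym : {M N : Multiset n} → M ≈ₘ N → N ≈ₘ M
  ≈ₘ-sym M≈N i = ≡.sym (M≈N i)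

  ≈ₘ-trans : {K M N : Multiset n} → K ≈ₘ M → M ≈ₘ N → K ≈ₘ N
  ≈ₘ-trans K≈M M≈N i = trans (K≈M i) (M≈N i)

  ⊎ₘ-congʳ : {M N : Multiset n} (K : Multiset n) → M ≈ₘ N → M ⊎ₘ K ≈ₘ N ⊎ₘ K
  ⊎ₘ-congʳ K M≈N i = cong (_+ K i) (M≈N i)

  ⊎ₘ-rightComm : (M K L : Multiset n) → M ⊎ₘ K ⊎ₘ L ≈ₘ M ⊎ₘ L ⊎ₘ K
  ⊎ₘ-rightComm M K L i = xy∙z≈xz∙y (M i) (K i) (L i)

  ⊎ₘ⟦⟧-cancelʳ : {M N : Multiset n} {u : Fin n} → M ⊎ₘ ⟦ u ⟧ ≈ₘ N ⊎ₘ ⟦ u ⟧ → M ≈ₘ N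
  ⊎ₘ⟦⟧-cancelʳ {M} {N} {u} e i = +-cancelʳ-≡ (⟦ u ⟧ i) (M i) (N i) (e i)

  ⊎ₘ⟦⟧-exchange : {M N : Multiset n} {a b : Fin n} → a ≢ b → M ⊎ₘ ⟦ a ⟧ ≈ₘ N ⊎ₘ ⟦ b ⟧ →
                  Σ (Multiset n) λ T → M ≈ₘ T ⊎ₘ ⟦ b ⟧ × N ≈ₘ T ⊎ₘ ⟦ a ⟧
  ⊎ₘ⟦⟧-exchange {M} {N} {a} {b} a≢b e = T , M≈T⊎b , N≈T⊎a
    where
    open ≡-Reasoning

    T : Multiset n
    T i = M i ∸ ⟦ b ⟧ i

    b∈M : M b ≡ suc (N b)
    b∈M = begin
      M b               ≡⟨ ⊎ₘ⟦⟧-other M a≢b ⟨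
      (M ⊎ₘ ⟦ a ⟧) b    ≡⟨ e b ⟩
      (N ⊎ₘ ⟦ b ⟧) b    ≡⟨ ⊎ₘ⟦⟧-self N b ⟩
      suc (N b)         ∎

    ⟦b⟧≤M : ∀ i → ⟦ b ⟧ i ≤ M i
    ⟦b⟧≤M i with b ≟ i
    ... | yes refl = subst (1 ≤_) (≡.sym b∈M) (s≤s z≤n)
    ... | no _     = z≤n

    M≈T⊎b : M ≈ₘ T ⊎ₘ ⟦ b ⟧
    M≈T⊎b i = ≡.sym (m∸n+n≡m (⟦b⟧≤M i))

    N≈T⊎a : N ≈ₘ T ⊎ₘ ⟦ a ⟧
    N≈T⊎a i = +-cancelʳ-≡ (⟦ b ⟧ i) (N i) (T i + ⟦ a ⟧ i) (begin
      N i + ⟦ b ⟧ i           ≡⟨ e i ⟨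
      M i + ⟦ a ⟧ i           ≡⟨ cong (_+ ⟦ a ⟧ i) (M≈T⊎b i) ⟩
      T i + ⟦ b ⟧ i + ⟦ a ⟧ i ≡⟨ xy∙z≈xz∙y (T i) (⟦ b ⟧ i) (⟦ a ⟧ i) ⟩
      T i + ⟦ a ⟧ i + ⟦ b ⟧ i ∎)

Move : ∀ {n} → Multiset n → Fin n → Fin n → Multiset n → Set
Move {n} A p q C = Σ (Multiset n) λ S → A ≈ₘ S ⊎ₘ ⟦ p ⟧ × C ≈ₘ S ⊎ₘ ⟦ q ⟧

module _ {n : ℕ} {A C : Multiset n} where
  open ≤-Reasoning

  move-sym : ∀ {p q} → Move A p q C → Move C q p A
  move-sym (S , A≈S⊎p , C≈S⊎q) = S , C≈S⊎q , A≈S⊎p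

  move-source : ∀ {p q i} → Move A p q C → C i < A i → p ≡ i
  move-source {p} {q} {i} (S , A≈S⊎p , C≈S⊎q) C<A with p ≟ i
  ... | yes p≡i = p≡i
  ... | no p≢i  = ⊥-elim (<⇒≱ C<A (begin
    A i                ≡⟨ A≈S⊎p i ⟩
    (S ⊎ₘ ⟦ p ⟧) i     ≡⟨ ⊎ₘ⟦⟧-other S p≢i ⟩
    S i                ≤⟨ m≤m+n (S i) (⟦ q ⟧ i) ⟩
    (S ⊎ₘ ⟦ q ⟧) i     ≡⟨ C≈S⊎q i ⟨
    C i                ∎))

  move-excess≤1 : ∀ {p q} i → Move A p q C → A i ≤ suc (C i)
  move-excess≤1 {p} {q} i (S , A≈S⊎p , C≈S⊎q) = begin
    A i                ≡⟨ A≈S⊎p i ⟩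
    S i + ⟦ p ⟧ i      ≤⟨ +-monoʳ-≤ (S i) (⟦⟧≤1 p i) ⟩
    S i + 1            ≡⟨ +-comm (S i) 1 ⟩
    suc (S i)          ≤⟨ s≤s (m≤m+n (S i) (⟦ q ⟧ i)) ⟩
    suc (S i + ⟦ q ⟧ i) ≡⟨ cong suc (C≈S⊎q i) ⟨
    suc (C i)          ∎

  move-source-unique : ∀ {a c p q} → a ≢ c → Move A a c C → Move A p q C → p ≡ a
  move-source-unique {a} {c} a≢c (R , A≈R⊎a , C≈R⊎c) m = move-source m (begin-strict
    C a                ≡⟨ C≈R⊎c a ⟩
    (R ⊎ₘ ⟦ c ⟧) a     ≡⟨ ⊎ₘ⟦⟧-other R (≢-sym a≢c) ⟩
    R a                <⟨ n<1+n (R a) ⟩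
    suc (R a)          ≡⟨ ⊎ₘ⟦⟧-self R a ⟨
    (R ⊎ₘ ⟦ a ⟧) a     ≡⟨ A≈R⊎a a ⟨
    A a                ∎)

move-endpoints-unique : ∀ {n} {A C : Multiset n} {a c p q} → a ≢ c →
                        Move A a c C → Move A p q C → p ≡ a × q ≡ c
move-endpoints-unique a≢c m m′ =
  move-source-unique a≢c m m′ ,
  move-source-unique (≢-sym a≢c) (move-sym m) (move-sym m′)

move-between-pairs-meet : ∀ {n} {A C R : Multiset n} {a b c d p q} →
                     A ≈ₘ R ⊎ₘ ⟦ a ⟧ ⊎ₘ ⟦ b ⟧ → C ≈ₘ R ⊎ₘ ⟦ c ⟧ ⊎ₘ ⟦ d ⟧ → Move A p q C →
                     a ≢ c → a ≢ d → b ≢ c → b ≡ d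
move-between-pairs-meet {A = A} {C} {R} {a} {b} {c} {d} {p} A≈R⊎a⊎b C≈R⊎c⊎d m a≢c a≢d b≢c
  with b ≟ d
... | yes b≡d = b≡d
... | no b≢d  = ⊥-elim (double-token a≢c a≢d
                  (subst (λ j → A ≈ₘ R ⊎ₘ ⟦ a ⟧ ⊎ₘ ⟦ j ⟧) (≡.sym a≡b) A≈R⊎a⊎b))
  where
  open ≤-Reasoning

  C-off-pair : ∀ {i} → i ≢ c → i ≢ d → C i ≡ R i
  C-off-pair {i} i≢c i≢d = trans (C≈R⊎c⊎d i)
    (trans (⊎ₘ⟦⟧-other (R ⊎ₘ ⟦ c ⟧) (≢-sym i≢d)) (⊎ₘ⟦⟧-other R (≢-sym i≢c)))

  A-on-pair : ∀ {i j} → A ≈ₘ R ⊎ₘ ⟦ i ⟧ ⊎ₘ ⟦ j ⟧ → suc (R i) ≤ A i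
  A-on-pair {i} {j} A≈R⊎i⊎j = begin
    suc (R i)                ≡⟨ ⊎ₘ⟦⟧-self R i ⟨
    (R ⊎ₘ ⟦ i ⟧) i           ≤⟨ m≤m+n _ (⟦ j ⟧ i) ⟩
    (R ⊎ₘ ⟦ i ⟧ ⊎ₘ ⟦ j ⟧) i  ≡⟨ A≈R⊎i⊎j i ⟨
    A i                      ∎

  source : ∀ {i j} → i ≢ c → i ≢ d → A ≈ₘ R ⊎ₘ ⟦ i ⟧ ⊎ₘ ⟦ j ⟧ → p ≡ i
  source {i} i≢c i≢d A≈R⊎i⊎j = move-source m (begin-strict
    C i        ≡⟨ C-off-pair i≢c i≢d ⟩
    R i        <⟨ A-on-pair A≈R⊎i⊎j ⟩
    A i        ∎)

  a≡b : a ≡ b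
  a≡b = trans (≡.sym (source a≢c a≢d A≈R⊎a⊎b))
              (source b≢c b≢d (≈ₘ-trans A≈R⊎a⊎b (⊎ₘ-rightComm R ⟦ a ⟧ ⟦ b ⟧)))

  double-token : ∀ {i} → i ≢ c → i ≢ d → A ≈ₘ R ⊎ₘ ⟦ i ⟧ ⊎ₘ ⟦ i ⟧ → ⊥
  double-token {i} i≢c i≢d A≈R⊎i⊎i = 1+n≰n (begin
    suc (suc (R i))          ≡⟨ cong suc (⊎ₘ⟦⟧-self R i) ⟨
    suc ((R ⊎ₘ ⟦ i ⟧) i)     ≡⟨ ⊎ₘ⟦⟧-self (R ⊎ₘ ⟦ i ⟧) i ⟨
    (R ⊎ₘ ⟦ i ⟧ ⊎ₘ ⟦ i ⟧) i  ≡⟨ A≈R⊎i⊎i i ⟨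
    A i                      ≤⟨ move-excess≤1 i m ⟩
    suc (C i)                ≡⟨ cong suc (C-off-pair i≢c i≢d) ⟩
    suc (R i)                ∎)

module _ {n : ℕ} (G : SimpleGraph n) {k : ℕ} {A B C : Multiset n} where

  adj⇒≢ : ∀ {u v} → Adj G u v → u ≢ v
  adj⇒≢ uv refl = irrefl G uv

  common-base⇒Type1 : ∀ {S u v y} → size S + 1 ≡ k → Adj G u v → Adj G v y → ¬ (A ≈ₘ C) →
                      A ≈ₘ S ⊎ₘ ⟦ u ⟧ → B ≈ₘ S ⊎ₘ ⟦ v ⟧ → C ≈ₘ S ⊎ₘ ⟦ y ⟧ →
                      SupertokenAdj G k A C → Type1 G k A B C
  common-base⇒Type1 {S} {u} {v} {y} |S|+1≡k uv vy A≉C A≈S⊎u B≈S⊎v C≈S⊎y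
                    (S″ , _ , p , q , pq , A≈S″⊎p , C≈S″⊎q) =
    S , |S|+1≡k , u , v , y , (uv , vy , uy) , A≈S⊎u , B≈S⊎v , C≈S⊎y
    where
    u≢y : u ≢ y
    u≢y refl = A≉C (≈ₘ-trans A≈S⊎u (≈ₘ-sym C≈S⊎y))

    uy : Adj G u y
    uy with move-endpoints-unique u≢y (S , A≈S⊎u , C≈S⊎y) (S″ , A≈S″⊎p , C≈S″⊎q)
    ... | p≡u , q≡y = subst₂ (Adj G) p≡u q≡y pq

  common-core⇒Type2 : ∀ {T u x v} → size T + 2 ≡ k → Adj G u v → Adj G x u → x ≢ v →
                      A ≈ₘ T ⊎ₘ ⟦ x ⟧ ⊎ₘ ⟦ u ⟧ → B ≈ₘ T ⊎ₘ ⟦ x ⟧ ⊎ₘ ⟦ v ⟧ →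
                      C ≈ₘ T ⊎ₘ ⟦ v ⟧ ⊎ₘ ⟦ u ⟧ → SupertokenAdj G k A C → Type2 G k A B C
  common-core⇒Type2 {T} {u} {x} {v} |T|+2≡k uv xu x≢v A≈T⊎x⊎u B≈T⊎x⊎v C≈T⊎v⊎u
                    (S″ , _ , p , q , pq , A≈S″⊎p , C≈S″⊎q) =
    T , |T|+2≡k , u , x , v , (sym G xu , xv , uv) , A≈T⊎x⊎u , B≈T⊎x⊎v , C≈T⊎v⊎u
    where
    x-to-v : Move A x v C
    x-to-v = T ⊎ₘ ⟦ u ⟧ ,
             ≈ₘ-trans A≈T⊎x⊎u (⊎ₘ-rightComm T ⟦ x ⟧ ⟦ u ⟧) ,
             ≈ₘ-trans C≈T⊎v⊎u (⊎ₘ-rightComm T ⟦ v ⟧ ⟦ u ⟧)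

    xv : Adj G x v
    xv with move-endpoints-unique x≢v x-to-v (S″ , A≈S″⊎p , C≈S″⊎q)
    ... | p≡x , q≡v = subst₂ (Adj G) p≡x q≡v pq

  distinct-bases⇒Type2 : ∀ {S S′ u v x y} → size S + 1 ≡ k → Adj G u v → Adj G x y → v ≢ x →
                         A ≈ₘ S ⊎ₘ ⟦ u ⟧ → B ≈ₘ S ⊎ₘ ⟦ v ⟧ → B ≈ₘ S′ ⊎ₘ ⟦ x ⟧ →
                         C ≈ₘ S′ ⊎ₘ ⟦ y ⟧ → SupertokenAdj G k A C → Type2 G k A B C
  distinct-bases⇒Type2 {S} {S′} {u} {v} {x} {y} |S|+1≡k uv xy v≢x
                       A≈S⊎u B≈S⊎v B≈S′⊎x C≈S′⊎y A~C@(S″ , _ , _ , _ , _ , A≈S″⊎p , C≈S″⊎q)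
    with ⊎ₘ⟦⟧-exchange v≢x (≈ₘ-trans (≈ₘ-sym B≈S⊎v) B≈S′⊎x)
  ... | T , S≈T⊎x , S′≈T⊎v
    with move-between-pairs-meet (≈ₘ-trans A≈S⊎u (⊎ₘ-congʳ ⟦ u ⟧ S≈T⊎x))
                            (≈ₘ-trans C≈S′⊎y (⊎ₘ-congʳ ⟦ y ⟧ S′≈T⊎v))
                            (S″ , A≈S″⊎p , C≈S″⊎q) (≢-sym v≢x) (adj⇒≢ xy) (adj⇒≢ uv)
  ... | refl =
    common-core⇒Type2 |T|+2≡k uv xy (≢-sym v≢x)
      (≈ₘ-trans A≈S⊎u (⊎ₘ-congʳ ⟦ u ⟧ S≈T⊎x))
      (≈ₘ-trans B≈S⊎v (⊎ₘ-congʳ ⟦ v ⟧ S≈T⊎x))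
      (≈ₘ-trans C≈S′⊎y (⊎ₘ-congʳ ⟦ u ⟧ S′≈T⊎v))
      A~C
    where
    open ≡-Reasoning
    |T|+2≡k : size T + 2 ≡ k
    |T|+2≡k = begin
      size T + 2              ≡⟨ +-assoc (size T) 1 1 ⟨
      size T + 1 + 1          ≡⟨ cong (_+ 1) (size-⊎ₘ⟦⟧ T x) ⟨
      size (T ⊎ₘ ⟦ x ⟧) + 1   ≡⟨ cong (_+ 1) (size-cong S≈T⊎x) ⟨
      size S + 1              ≡⟨ |S|+1≡k ⟩
      k                       ∎

  supertoken-triangle-type : ¬ (A ≈ₘ C) → SupertokenAdj G k A B → SupertokenAdj G k B C →
                             SupertokenAdj G k A C → Type1 G k A B C ⊎ Type2 G k A B C
  supertoken-triangle-type A≉C (S , |S|+1≡k , u , v , uv , A≈S⊎u , B≈S⊎v)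
                               (S′ , _ , x , y , xy , B≈S′⊎x , C≈S′⊎y) A~C with v ≟ x
  ... | yes refl = inj₁ (common-base⇒Type1 |S|+1≡k uv xy A≉C A≈S⊎u B≈S⊎v C≈S⊎y A~C)
    where
    C≈S⊎y : C ≈ₘ S ⊎ₘ ⟦ y ⟧
    C≈S⊎y = ≈ₘ-trans C≈S′⊎y (⊎ₘ-congʳ ⟦ y ⟧ (⊎ₘ⟦⟧-cancelʳ (≈ₘ-trans (≈ₘ-sym B≈S′⊎x) B≈S⊎v)))
  ... | no v≢x = inj₂ (distinct-bases⇒Type2 |S|+1≡k uv xy v≢x A≈S⊎u B≈S⊎v B≈S′⊎x C≈S′⊎y A~C)

  supertoken-type⇒HasTriangle : Type1 G k A B C ⊎ Type2 G k A B C → HasTriangle G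
  supertoken-type⇒HasTriangle (inj₁ (_ , _ , a , b , c , abc , _)) = a , b , c , abc
  supertoken-type⇒HasTriangle (inj₂ (_ , _ , a , b , c , abc , _)) = a , b , c , abc

mainTheorem6 : ∀ {n} (G : SimpleGraph n) (k : ℕ) → k ≥ 1 →
    (X : Fin 3 → Multiset n) → IsSupertokenTriangle G k X →
    HasTriangle G ×
    Σ (Fin 3 → Fin 3) λ σ → Injective _≡_ _≡_ σ ×
      (Type1 G k (X (σ zero)) (X (σ (suc zero))) (X (σ (suc (suc zero))))
       ⊎ Type2 G k (X (σ zero)) (X (σ (suc zero))) (X (σ (suc (suc zero)))))
mainTheorem6 G k _ X (_ , distinct , adjacent) =
  supertoken-type⇒HasTriangle G type , id , id , type
  where
  type : Type1 G k (X zero) (X (suc zero)) (X (suc (suc zero)))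
         ⊎ Type2 G k (X zero) (X (suc zero)) (X (suc (suc zero)))
  type = supertoken-triangle-type G (distinct zero (suc (suc zero)) λ ())
           (adjacent zero (suc zero) λ ())
           (adjacent (suc zero) (suc (suc zero)) λ ())
           (adjacent zero (suc (suc zero)) λ ())
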